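{- Let $\Sigma$ be a signature with Lawvere theory $\mathcal{L}_\Sigma$. For $H:\mathcal{L}_\Sigma^{op}\to Poset$ and each natural number $n$, let $\int\! H(n)$ be the colimit in $Poset$ of the composite $n/Inj\xrightarrow{cod}Inj\xrightarrow{J^{op}}\mathcal{L}_\Sigma^{op}\xrightarrow{H}Poset$, with colimit injections $\rho_j:H(m)\to\int\! H(n)$ for $j:n\to m$ in $n/Inj$. For a map $f:n\to n'$ of $\mathcal{L}_\Sigma$, define $\int\! H(f):\int\! H(n')\to\int\! H(n)$ as the map induced by the cocone whose component at (an object isomorphic to) the canonical injection $n'\to n'+k$ is $\rho_{j}\circ H(f+k):H(n'+k)\to H(n+k)\to\int\! H(n)$, where $j:n\to n+k$ is the canonical injection. For a map $\alpha:H\to K$ of $Lax_{Inj}(\mathcal{L}_\Sigma^{op},Poset)$, define $(\int\!\alpha)_n:\int\! H(n)\to\int\! K(n)$ as the map induced by the cocone whose component at the canonical injection $j:n\to n+k$ is $\rho^K_{j}\circ\alpha_{n+k}:H(n+k)\to K(n+k)\to\int\! K(n)$. Then these data define an endofunctor $\int:Lax_{Inj}(\mathcal{L}_\Sigma^{op},Poset)\to Lax_{Inj}(\mathcal{L}_\Sigma^{op},Poset)$.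
   Context: A signature $\Sigma$ is a set of function symbols with arities. The Lawvere theory $\mathcal{L}_\Sigma$ has natural numbers as objects; for each $n$ fix distinct variables $x_1,\ldots,x_n$; $\mathcal{L}_\Sigma(n,m)$ is the set of $m$-tuples of terms over $\Sigma$ in $x_1,\ldots,x_n$, with composition by substitution. For $f=(f_1,\ldots,f_{n'}):n\to n'$, $f+k:n+k\to n'+k$ is the tuple $(f_1,\ldots,f_{n'},x_{n+1},\ldots,x_{n+k})$. $Inj$ is the category of natural numbers and injections; $J:Inj^{op}\to\mathcal{L}_\Sigma$ is the canonical identity-on-objects functor (an injection $i:n\to m$ is sent to the map $m\to n$ given by the tuple of variables $(x_{i(1)},\ldots,x_{i(n)})$). Every object $j:n\to m$ of the comma category $n/Inj$ is isomorphic to the canonical inclusion $n\to n+k$ for a unique $k$. For functors $H,K:\mathcal{L}_\Sigma^{op}\to Poset$, a lax transformation $\alpha:H\to K$ is a family of order-preserving maps $\alpha_n:Hn\to Kn$ such that for every $f:n\to m$ in $\mathcal{L}_\Sigma$, $(Kf)\circ\alpha_m\le\alpha_n\circ(Hf)$ pointwise. $Lax_{Inj}(\mathcal{L}_\Sigma^{op},Poset)$ is the category whose objects are functors $\mathcal{L}_\Sigma^{op}\to Poset$ and whose maps are lax transformations $\alpha$ that strictly respect injections, i.e. $K(Ji)\circ\alpha_n=\alpha_m\circ H(Ji)$ for every injection $i:n\to m$, with pointwise composition. -}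

module Defs where

open import Level using (0ℓ) renaming (suc to lsuc)
open import Data.Nat using (ℕ; _+_)
open import Data.Fin using (Fin; _↑ˡ_; _↑ʳ_)
open import Data.Fin.Properties using (↑ˡ-injective)
open import Data.Vec using (Vec; []; _∷_; tabulate; _++_)
import Data.Vec as Vec
open import Data.Product using (Σ; _×_; _,_; proj₁; proj₂)
open import Function.Definitions using (Injective)
open import Relation.Binary.PropositionalEquality using (_≡_; refl)
open import Relation.Binary.Bundles using (Poset)
open import Relation.Binary.Morphism.Bundles using (PosetHomomorphism)
open import Relation.Binary.Construct.Closure.ReflexiveTransitive using (Star; ε; _◅_; _◅◅_)

record Signature : Set₁ where
  field
    Sym   : Set
    arity : Sym → ℕ

Pos : Set₁
Pos = Poset 0ℓ 0ℓ 0ℓ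

Mono : Pos → Pos → Set
Mono P Q = PosetHomomorphism P Q

infixr 5 _⟨$⟩_
_⟨$⟩_ : ∀ {P Q} → Mono P Q → Poset.Carrier P → Poset.Carrier Q
f ⟨$⟩ x = PosetHomomorphism.⟦_⟧ f x

record Inj (n m : ℕ) : Set where
  constructor mkInj
  field
    fun : Fin n → Fin m
    inj : Injective _≡_ _≡_ fun
open Inj public

incl : ∀ n k → Inj n (n + k)
incl n k = mkInj (λ a → a ↑ˡ k) (λ {a} {b} eq → ↑ˡ-injective k a b eq)

module Lawvere (Sig : Signature) where
  open Signature Sig

  data Term (n : ℕ) : Set where
    var : Fin n → Term n
    app : (s : Sym) → Vec (Term n) (arity s) → Term n

  -- morphisms n → m : m-tuples of terms in the variables x_1..x_n
  Hom : ℕ → ℕ → Set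
  Hom n m = Vec (Term n) m

  mutual
    sub : ∀ {n m} → Term m → Hom n m → Term n
    sub (var a)    σ = Vec.lookup σ a
    sub (app s ts) σ = app s (subs ts σ)

    subs : ∀ {n m k} → Vec (Term m) k → Hom n m → Vec (Term n) k
    subs []       σ = []
    subs (t ∷ ts) σ = sub t σ ∷ subs ts σ

  idₗ : ∀ n → Hom n n
  idₗ n = tabulate var

  _∘ₗ_ : ∀ {n n' n''} → Hom n' n'' → Hom n n' → Hom n n''
  g ∘ₗ f = subs g f

  _+ₗ_ : ∀ {n n'} → Hom n n' → ∀ k → Hom (n + k) (n' + k)
  _+ₗ_ {n} f k =
    subs f (tabulate (λ a → var (a ↑ˡ k))) ++ tabulate (λ b → var (n ↑ʳ b))

  -- J : Inj^op → L_Σ ; an injection i : n → m goes to the map m → n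
  -- given by the tuple (x_{i(1)}, …, x_{i(n)}).
  J : ∀ {n m} → Inj n m → Hom m n
  J i = tabulate (λ a → var (fun i a))

  record PFunctor : Set₁ where
    field
      obj    : ℕ → Pos
      hom    : ∀ {n m} → Hom n m → Mono (obj m) (obj n)
      hom-id : ∀ n (x : Poset.Carrier (obj n)) →
               Poset._≈_ (obj n) (hom (idₗ n) ⟨$⟩ x) x
      hom-∘  : ∀ {n n' n''} (f : Hom n n') (g : Hom n' n'')
               (x : Poset.Carrier (obj n'')) →
               Poset._≈_ (obj n) (hom (g ∘ₗ f) ⟨$⟩ x) (hom f ⟨$⟩ (hom g ⟨$⟩ x))
  open PFunctor public

  record LaxInj (H K : PFunctor) : Set where
    field
      comp   : ∀ n → Mono (obj H n) (obj K n)
      lax    : ∀ {n m} (f : Hom n m) (x : Poset.Carrier (obj H m)) →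
               Poset._≤_ (obj K n) (hom K f ⟨$⟩ (comp m ⟨$⟩ x))
                                   (comp n ⟨$⟩ (hom H f ⟨$⟩ x))
      strict : ∀ {n m} (i : Inj n m) (x : Poset.Carrier (obj H n)) →
               Poset._≈_ (obj K m) (hom K (J i) ⟨$⟩ (comp n ⟨$⟩ x))
                                   (comp m ⟨$⟩ (hom H (J i) ⟨$⟩ x))
  open LaxInj public

  -- The colimit ∫H(n) in Poset of  n/Inj --cod--> Inj --J^op--> L^op --H--> Poset,
  -- built in the standard way: the disjoint union over the objects
  -- j : n → m of n/Inj of H(m), with the preorder generated by the orders
  -- of the components and the identifications x ~ H(J g)(x) for each
  -- morphism g : j → j' of n/Inj, then made a poset by antisymmetrisation.

  module Colim (H : PFunctor) (n : ℕ) where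

    record Elt : Set where
      constructor el
      field
        cod : ℕ
        arr : Inj n cod
        val : Poset.Carrier (obj H cod)

    data Step : Elt → Elt → Set where
      within : ∀ {m} {j : Inj n m} {x y} →
               Poset._≤_ (obj H m) x y → Step (el m j x) (el m j y)
      fwd    : ∀ {m m'} {j : Inj n m} {j' : Inj n m'} (g : Inj m m') →
               (∀ a → fun g (fun j a) ≡ fun j' a) → ∀ x →
               Step (el m j x) (el m' j' (hom H (J g) ⟨$⟩ x))
      bwd    : ∀ {m m'} {j : Inj n m} {j' : Inj n m'} (g : Inj m m') →
               (∀ a → fun g (fun j a) ≡ fun j' a) → ∀ x →
               Step (el m' j' (hom H (J g) ⟨$⟩ x)) (el m j x)

    _≤_ : Elt → Elt → Set
    _≤_ = Star Step

    _≈_ : Elt → Elt → Set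
    x ≈ y = (x ≤ y) × (y ≤ x)

    poset : Pos
    poset = record
      { Carrier = Elt
      ; _≈_ = _≈_
      ; _≤_ = _≤_
      ; isPartialOrder = record
        { isPreorder = record
          { isEquivalence = record
            { refl  = ε , ε
            ; sym   = λ p → proj₂ p , proj₁ p
            ; trans = λ p q → (proj₁ p ◅◅ proj₁ q) , (proj₂ q ◅◅ proj₂ p) }
          ; reflexive = proj₁
          ; trans = _◅◅_ }
        ; antisym = _,_ } }

    ρ : ∀ {m} → Inj n m → Mono (obj H m) poset
    ρ {m} j = record
      { ⟦_⟧ = λ x → el m j x
      ; isOrderHomomorphism = record
        { cong = λ x≈y → (within (Poset.reflexive (obj H m) x≈y) ◅ ε)
                       , (within (Poset.reflexive (obj H m)
                            (Poset.Eq.sym (obj H m) x≈y)) ◅ ε)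
        ; mono = λ x≤y → within x≤y ◅ ε } }

  ∫ : PFunctor → ℕ → Pos
  ∫ H n = Colim.poset H n

  ρ[_] : ∀ (H : PFunctor) {n m} → Inj n m → Mono (obj H m) (∫ H n)
  ρ[ H ] {n} j = Colim.ρ H n j

  -- Data of the functor ∫H: the action on maps f : n → n', i.e. the
  -- map ∫H(n') → ∫H(n) induced by the cocone with components
  -- ρ_{n→n+k} ∘ H(f + k) at the canonical injections n' → n' + k,
  -- together with the functor laws.

  record ∫FunctorData (H : PFunctor) : Set where
    field
      act    : ∀ {n n'} → Hom n n' → Mono (∫ H n') (∫ H n)
      act-ρ  : ∀ {n n'} (f : Hom n n') k (x : Poset.Carrier (obj H (n' + k))) →
               Poset._≈_ (∫ H n) (act f ⟨$⟩ (ρ[ H ] (incl n' k) ⟨$⟩ x))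
                                 (ρ[ H ] (incl n k) ⟨$⟩ (hom H (f +ₗ k) ⟨$⟩ x))
      act-id : ∀ n (x : Poset.Carrier (∫ H n)) →
               Poset._≈_ (∫ H n) (act (idₗ n) ⟨$⟩ x) x
      act-∘  : ∀ {n n' n''} (f : Hom n n') (g : Hom n' n'')
               (x : Poset.Carrier (∫ H n'')) →
               Poset._≈_ (∫ H n) (act (g ∘ₗ f) ⟨$⟩ x) (act f ⟨$⟩ (act g ⟨$⟩ x))

  ∫F : (H : PFunctor) → ∫FunctorData H → PFunctor
  ∫F H D = record
    { obj = ∫ H
    ; hom = ∫FunctorData.act D
    ; hom-id = ∫FunctorData.act-id D
    ; hom-∘ = ∫FunctorData.act-∘ D }

  -- Data of ∫α for α : H → K: a map of Lax_Inj between ∫H and ∫K whose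
  -- component at n is induced by the cocone with components
  -- ρ^K_{n→n+k} ∘ α_{n+k} at the canonical injections n → n + k.

  record ∫MapData {H K : PFunctor} (DH : ∫FunctorData H) (DK : ∫FunctorData K)
                  (α : LaxInj H K) : Set where
    field
      map   : LaxInj (∫F H DH) (∫F K DK)
      map-ρ : ∀ n k (x : Poset.Carrier (obj H (n + k))) →
              Poset._≈_ (∫ K n) (comp map n ⟨$⟩ (ρ[ H ] (incl n k) ⟨$⟩ x))
                                (ρ[ K ] (incl n k) ⟨$⟩ (comp α (n + k) ⟨$⟩ x))

  idLax : (H : PFunctor) → LaxInj H H
  idLax H = record
    { comp = λ n → record
        { ⟦_⟧ = λ x → x
        ; isOrderHomomorphism = record { cong = λ p → p ; mono = λ p → p } }
    ; lax = λ {n} f x → Poset.refl (obj H n)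
    ; strict = λ {n} {m} i x → Poset.Eq.refl (obj H m) }

  _∘Lax_ : ∀ {H K L} → LaxInj K L → LaxInj H K → LaxInj H L
  _∘Lax_ {H} {K} {L} β α = record
    { comp = λ n → record
        { ⟦_⟧ = λ x → comp β n ⟨$⟩ (comp α n ⟨$⟩ x)
        ; isOrderHomomorphism = record
          { cong = λ p → PosetHomomorphism.cong (comp β n)
                           (PosetHomomorphism.cong (comp α n) p)
          ; mono = λ p → PosetHomomorphism.mono (comp β n)
                           (PosetHomomorphism.mono (comp α n) p) } }
    ; lax = λ {n} {m} f x →
        Poset.trans (obj L n) (lax β f (comp α m ⟨$⟩ x))
                              (PosetHomomorphism.mono (comp β n) (lax α f x))
    ; strict = λ {n} {m} i x →
        Poset.Eq.trans (obj L m) (strict β i (comp α n ⟨$⟩ x))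
                                 (PosetHomomorphism.cong (comp β m) (strict α i x)) }

-- Every object j : n → m of n/Inj has a morphism toCanonical j into the canonical
-- injection n → n + m (send j(a) to a and any other b to n + b). Hence the cocone
-- defining ∫H(f), given only at canonical injections, extends to all of n/Inj, and
-- it respects the colimit identifications because f + k is natural in k along
-- injections, (f + k) ∘ J(id ⊕ h) = J(id ⊕ h) ∘ (f + k'). The functor laws of ∫H
-- reduce to those of H through (g ∘ f) + k = (g + k) ∘ (f + k) and id + k = id.
-- The map ∫α applies α to representatives: strictness of α on injections makes this
-- respect the identifications (and makes ∫α strict), and laxity of α gives laxity.
module Submission where

open import Defs
open import Data.Empty using (⊥-elim)
open import Data.Fin using (Fin; zero; suc; _↑ˡ_; _↑ʳ_; splitAt; join)
open import Data.Fin.Properties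
  using (↑ˡ-injective; ↑ʳ-injective; splitAt-↑ˡ; splitAt-↑ʳ; splitAt-join; join-splitAt; any?; _≟_)
open import Data.Nat using (zero; suc; _+_)
open import Data.Product using (Σ-syntax; _×_; _,_; ∃)
open import Data.Sum as Sum using (inj₁; inj₂)
open import Data.Sum.Properties using (inj₁-injective; inj₂-injective)
open import Data.Vec using ([]; _∷_; tabulate; lookup)
open import Data.Vec.Properties using (lookup∘tabulate; tabulate-cong; lookup-++ˡ; lookup-++ʳ)
open import Data.Vec.Relation.Binary.Pointwise.Extensional using (ext; Pointwise-≡⇒≡)
open import Function using (_∘_; id)
open import Function.Definitions using (Injective)
open import Relation.Binary.Bundles using (Poset)
open import Relation.Binary.Morphism.Bundles using (PosetHomomorphism)
import Relation.Binary.Morphism.Construct.Composition as Composition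
open import Relation.Binary.Construct.Closure.ReflexiveTransitive using (ε; _◅_; gfold)
open import Relation.Binary.PropositionalEquality
  using (_≡_; _≢_; refl; sym; trans; cong; cong₂; module ≡-Reasoning)
open import Relation.Nullary using (Dec; yes; no)
import Relation.Binary.Reasoning.Setoid as SetoidReasoning
import Relation.Binary.Reasoning.PartialOrder as PosetReasoning

Fin+-elim : ∀ {m k} (P : Fin (m + k) → Set) →
            (∀ a → P (a ↑ˡ k)) → (∀ b → P (m ↑ʳ b)) → ∀ c → P c
Fin+-elim {zero}  P left right c       = right c
Fin+-elim {suc m} P left right zero    = left zero
Fin+-elim {suc m} P left right (suc c) = Fin+-elim (P ∘ suc) (left ∘ suc) right c

↑ˡ≢↑ʳ : ∀ {m k} (a : Fin m) (b : Fin k) → a ↑ˡ k ≢ m ↑ʳ b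
↑ˡ≢↑ʳ {m} {k} a b eq
  with () ← trans (sym (splitAt-↑ˡ m a k)) (trans (cong (splitAt m) eq) (splitAt-↑ʳ m k b))

⊎-map-injective : ∀ {A B C D : Set} {f : A → C} {g : B → D} →
                  Injective _≡_ _≡_ f → Injective _≡_ _≡_ g →
                  Injective _≡_ _≡_ (Sum.map f g)
⊎-map-injective f-inj g-inj {inj₁ _} {inj₁ _} eq = cong inj₁ (f-inj (inj₁-injective eq))
⊎-map-injective f-inj g-inj {inj₂ _} {inj₂ _} eq = cong inj₂ (g-inj (inj₂-injective eq))
⊎-map-injective f-inj g-inj {inj₁ _} {inj₂ _} ()
⊎-map-injective f-inj g-inj {inj₂ _} {inj₁ _} ()

idInj : ∀ n → Inj n n
idInj n = mkInj id id

inclʳ : ∀ n k → Inj k (n + k)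
inclʳ n k = mkInj (n ↑ʳ_) λ {a} {b} eq → ↑ʳ-injective n a b eq

infix 4 _∙_≗_
_∙_≗_ : ∀ {n m m'} → Inj m m' → Inj n m → Inj n m' → Set
g ∙ j ≗ j' = ∀ a → fun g (fun j a) ≡ fun j' a

_⊕_ : ∀ {n m k k'} → Inj n m → Inj k k' → Inj (n + k) (m + k')
_⊕_ {n} {m} {k} {k'} i h = mkInj (join m k' ∘ Sum.map (fun i) (fun h) ∘ splitAt n) injective
  where
  open ≡-Reasoning
  injective : Injective _≡_ _≡_ (join m k' ∘ Sum.map (fun i) (fun h) ∘ splitAt n)
  injective {c} {c'} eq = begin
    c                       ≡⟨ join-splitAt n k c ⟨
    join n k (splitAt n c)  ≡⟨ cong (join n k) splits-eq ⟩
    join n k (splitAt n c') ≡⟨ join-splitAt n k c' ⟩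
    c'                      ∎
    where
    splits-eq : splitAt n c ≡ splitAt n c'
    splits-eq = ⊎-map-injective (inj i) (inj h)
      (trans (sym (splitAt-join m k' _)) (trans (cong (splitAt m) eq) (splitAt-join m k' _)))

module _ {n m k k'} (i : Inj n m) (h : Inj k k') where

  ⊕-↑ˡ : ∀ a → fun (i ⊕ h) (a ↑ˡ k) ≡ fun i a ↑ˡ k'
  ⊕-↑ˡ a = cong (join m k' ∘ Sum.map (fun i) (fun h)) (splitAt-↑ˡ n a k)

  ⊕-↑ʳ : ∀ b → fun (i ⊕ h) (n ↑ʳ b) ≡ m ↑ʳ fun h b
  ⊕-↑ʳ b = cong (join m k' ∘ Sum.map (fun i) (fun h)) (splitAt-↑ʳ n k b)

module _ {n m} (j : Inj n m) where

  image? : (b : Fin m) → Dec (∃ λ a → fun j a ≡ b)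
  image? b = any? λ a → fun j a ≟ b

  private
    position : (b : Fin m) → Dec (∃ λ a → fun j a ≡ b) → Fin (n + m)
    position b (yes (a , _)) = a ↑ˡ m
    position b (no _)        = n ↑ʳ b

  toCanonical : Inj m (n + m)
  toCanonical = mkInj (λ b → position b (image? b)) injective
    where
    injective : Injective _≡_ _≡_ (λ b → position b (image? b))
    injective {b} {b'} eq with image? b | image? b'
    ... | yes (a , refl) | yes (a' , refl) =
      cong (fun j) (↑ˡ-injective m a a' eq)
    ... | yes (a , _)    | no _            = ⊥-elim (↑ˡ≢↑ʳ _ _ eq)
    ... | no _           | yes (a' , _)    = ⊥-elim (↑ˡ≢↑ʳ _ _ (sym eq))
    ... | no _           | no _            = ↑ʳ-injective n b b' eq

  toCanonical-∙ : toCanonical ∙ j ≗ incl n m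
  toCanonical-∙ a with image? (fun j a)
  ... | yes (a' , eq) = cong (_↑ˡ m) (inj j eq)
  ... | no ∉          = ⊥-elim (∉ (a , refl))

  toCanonical-∉ : ∀ b → (∀ a → fun j a ≢ b) → fun toCanonical b ≡ n ↑ʳ b
  toCanonical-∉ b ∉ with image? b
  ... | yes (a , eq) = ⊥-elim (∉ a eq)
  ... | no _         = refl

toCanonical-natural : ∀ {n m m'} {j : Inj n m} {j' : Inj n m'} (g : Inj m m') →
                      g ∙ j ≗ j' → ∀ b →
                      fun (idInj n ⊕ g) (fun (toCanonical j) b) ≡ fun (toCanonical j') (fun g b)
toCanonical-natural {n} {j = j} {j'} g g∙j≗j' b = byImage (image? j b)
  where
  open ≡-Reasoning
  byImage : Dec (∃ λ a → fun j a ≡ b) →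
            fun (idInj n ⊕ g) (fun (toCanonical j) b) ≡ fun (toCanonical j') (fun g b)
  byImage (yes (a , refl)) = begin
    fun (idInj n ⊕ g) (fun (toCanonical j) (fun j a)) ≡⟨ cong (fun (idInj n ⊕ g)) (toCanonical-∙ j a) ⟩
    fun (idInj n ⊕ g) (a ↑ˡ _)                        ≡⟨ ⊕-↑ˡ (idInj n) g a ⟩
    a ↑ˡ _                                            ≡⟨ toCanonical-∙ j' a ⟨
    fun (toCanonical j') (fun j' a)                   ≡⟨ cong (fun (toCanonical j')) (g∙j≗j' a) ⟨
    fun (toCanonical j') (fun g (fun j a))            ∎
  byImage (no ∉) = begin
    fun (idInj n ⊕ g) (fun (toCanonical j) b) ≡⟨ cong (fun (idInj n ⊕ g)) (toCanonical-∉ j b ∉ʲ) ⟩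
    fun (idInj n ⊕ g) (n ↑ʳ b)                ≡⟨ ⊕-↑ʳ (idInj n) g b ⟩
    n ↑ʳ fun g b                              ≡⟨ toCanonical-∉ j' (fun g b) ∉ʲ' ⟨
    fun (toCanonical j') (fun g b)            ∎
    where
    ∉ʲ : ∀ a → fun j a ≢ b
    ∉ʲ a eq = ∉ (a , eq)
    ∉ʲ' : ∀ a → fun j' a ≢ fun g b
    ∉ʲ' a eq = ∉ (a , inj g (trans (g∙j≗j' a) eq))

toCanonical-incl : ∀ n k c → fun (toCanonical (incl n k)) c ≡ fun (idInj n ⊕ inclʳ n k) c
toCanonical-incl n k = Fin+-elim _
  (λ a → trans (toCanonical-∙ (incl n k) a) (sym (⊕-↑ˡ (idInj n) (inclʳ n k) a)))
  (λ b → trans (toCanonical-∉ (incl n k) (n ↑ʳ b) (λ a → ↑ˡ≢↑ʳ a b))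
               (sym (⊕-↑ʳ (idInj n) (inclʳ n k) b)))

infixr 9 _∘ᴹ_
_∘ᴹ_ : ∀ {P Q R} → Mono Q R → Mono P Q → Mono P R
g ∘ᴹ f = Composition.posetHomomorphism f g

module _ (Sig : Signature) where
  open Lawvere Sig

  Hom-ext : ∀ {n m} {f g : Hom n m} → (∀ a → lookup f a ≡ lookup g a) → f ≡ g
  Hom-ext p = Pointwise-≡⇒≡ (ext p)

  lookup-∘ₗ : ∀ {n n' n''} (g : Hom n' n'') (f : Hom n n') a → lookup (g ∘ₗ f) a ≡ sub (lookup g a) f
  lookup-∘ₗ (t ∷ g) f zero    = refl
  lookup-∘ₗ (t ∷ g) f (suc a) = lookup-∘ₗ g f a

  mutual
    sub-∘ₗ : ∀ {n m p} (t : Term p) (σ : Hom m p) (τ : Hom n m) → sub (sub t σ) τ ≡ sub t (σ ∘ₗ τ)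
    sub-∘ₗ (var a)    σ τ = sym (lookup-∘ₗ σ τ a)
    sub-∘ₗ (app s ts) σ τ = cong (app s) (∘ₗ-assoc ts σ τ)

    ∘ₗ-assoc : ∀ {n m p k} (ts : Hom p k) (σ : Hom m p) (τ : Hom n m) →
               (ts ∘ₗ σ) ∘ₗ τ ≡ ts ∘ₗ (σ ∘ₗ τ)
    ∘ₗ-assoc []       σ τ = refl
    ∘ₗ-assoc (t ∷ ts) σ τ = cong₂ _∷_ (sub-∘ₗ t σ τ) (∘ₗ-assoc ts σ τ)

  ren : ∀ {n m} → (Fin m → Fin n) → Hom n m
  ren ρ = tabulate (var ∘ ρ)

  lookup-ren : ∀ {n m} (ρ : Fin m → Fin n) a → lookup (ren ρ) a ≡ var (ρ a)
  lookup-ren ρ = lookup∘tabulate (var ∘ ρ)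

  ren-cong : ∀ {n m} {ρ σ : Fin m → Fin n} → (∀ a → ρ a ≡ σ a) → ren ρ ≡ ren σ
  ren-cong p = tabulate-cong (cong var ∘ p)

  lookup-ren-∘ₗ : ∀ {n m p} (ρ : Fin p → Fin m) (σ : Hom n m) a → lookup (ren ρ ∘ₗ σ) a ≡ lookup σ (ρ a)
  lookup-ren-∘ₗ ρ σ a = trans (lookup-∘ₗ (ren ρ) σ a) (cong (λ t → sub t σ) (lookup-ren ρ a))

  ren-∘ₗ-ren : ∀ {n m p} (ρ : Fin p → Fin m) (σ : Fin m → Fin n) → ren ρ ∘ₗ ren σ ≡ ren (σ ∘ ρ)
  ren-∘ₗ-ren ρ σ = Hom-ext λ a →
    trans (lookup-ren-∘ₗ ρ (ren σ) a) (trans (lookup-ren σ (ρ a)) (sym (lookup-ren (σ ∘ ρ) a)))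

  J-square : ∀ {p q q' r} (a : Inj q r) (b : Inj p q) (c : Inj q' r) (d : Inj p q') →
             (∀ z → fun a (fun b z) ≡ fun c (fun d z)) → J b ∘ₗ J a ≡ J d ∘ₗ J c
  J-square a b c d square = begin
    J b ∘ₗ J a            ≡⟨ ren-∘ₗ-ren (fun b) (fun a) ⟩
    ren (fun a ∘ fun b)   ≡⟨ ren-cong square ⟩
    ren (fun c ∘ fun d)   ≡⟨ ren-∘ₗ-ren (fun d) (fun c) ⟨
    J d ∘ₗ J c            ∎
    where open ≡-Reasoning

  weaken : ∀ n k → Hom (n + k) n
  weaken n k = ren (_↑ˡ k)

  lookup-+ₗ-↑ˡ : ∀ {n n'} (f : Hom n n') k a → lookup (f +ₗ k) (a ↑ˡ k) ≡ sub (lookup f a) (weaken n k)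
  lookup-+ₗ-↑ˡ {n} f k a = trans (lookup-++ˡ (f ∘ₗ weaken n k) _ a) (lookup-∘ₗ f (weaken n k) a)

  lookup-+ₗ-↑ʳ : ∀ {n n'} (f : Hom n n') k b → lookup (f +ₗ k) (n' ↑ʳ b) ≡ var (n ↑ʳ b)
  lookup-+ₗ-↑ʳ {n} f k b = trans (lookup-++ʳ (f ∘ₗ weaken n k) _ b) (lookup-ren (n ↑ʳ_) b)

  weaken-natural : ∀ {n n'} (f : Hom n n') k → weaken n' k ∘ₗ (f +ₗ k) ≡ f ∘ₗ weaken n k
  weaken-natural {n} f k = Hom-ext λ a →
    trans (lookup-ren-∘ₗ (_↑ˡ k) (f +ₗ k) a) (trans (lookup-+ₗ-↑ˡ f k a) (sym (lookup-∘ₗ f (weaken n k) a)))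

  +ₗ-identity : ∀ n k → idₗ n +ₗ k ≡ idₗ (n + k)
  +ₗ-identity n k = Hom-ext (Fin+-elim _ left right)
    where
    left : ∀ a → lookup (idₗ n +ₗ k) (a ↑ˡ k) ≡ lookup (idₗ (n + k)) (a ↑ˡ k)
    left a = begin
      lookup (idₗ n +ₗ k) (a ↑ˡ k)      ≡⟨ lookup-+ₗ-↑ˡ (idₗ n) k a ⟩
      sub (lookup (idₗ n) a) (weaken n k) ≡⟨ cong (λ t → sub t (weaken n k)) (lookup-ren id a) ⟩
      lookup (weaken n k) a              ≡⟨ lookup-ren (_↑ˡ k) a ⟩
      var (a ↑ˡ k)                       ≡⟨ lookup-ren id (a ↑ˡ k) ⟨
      lookup (idₗ (n + k)) (a ↑ˡ k)      ∎
      where open ≡-Reasoning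
    right : ∀ b → lookup (idₗ n +ₗ k) (n ↑ʳ b) ≡ lookup (idₗ (n + k)) (n ↑ʳ b)
    right b = trans (lookup-+ₗ-↑ʳ (idₗ n) k b) (sym (lookup-ren id (n ↑ʳ b)))

  +ₗ-∘ₗ : ∀ {n n' n''} (f : Hom n n') (g : Hom n' n'') k → (g ∘ₗ f) +ₗ k ≡ (g +ₗ k) ∘ₗ (f +ₗ k)
  +ₗ-∘ₗ {n} {n'} {n''} f g k = Hom-ext (Fin+-elim _ left right)
    where
    open ≡-Reasoning
    left : ∀ a → lookup ((g ∘ₗ f) +ₗ k) (a ↑ˡ k) ≡ lookup ((g +ₗ k) ∘ₗ (f +ₗ k)) (a ↑ˡ k)
    left a = begin
      lookup ((g ∘ₗ f) +ₗ k) (a ↑ˡ k)             ≡⟨ lookup-+ₗ-↑ˡ (g ∘ₗ f) k a ⟩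
      sub (lookup (g ∘ₗ f) a) (weaken n k)         ≡⟨ cong (λ t → sub t (weaken n k)) (lookup-∘ₗ g f a) ⟩
      sub (sub (lookup g a) f) (weaken n k)        ≡⟨ sub-∘ₗ (lookup g a) f (weaken n k) ⟩
      sub (lookup g a) (f ∘ₗ weaken n k)           ≡⟨ cong (sub (lookup g a)) (weaken-natural f k) ⟨
      sub (lookup g a) (weaken n' k ∘ₗ (f +ₗ k))   ≡⟨ sub-∘ₗ (lookup g a) (weaken n' k) (f +ₗ k) ⟨
      sub (sub (lookup g a) (weaken n' k)) (f +ₗ k) ≡⟨ cong (λ t → sub t (f +ₗ k)) (lookup-+ₗ-↑ˡ g k a) ⟨
      sub (lookup (g +ₗ k) (a ↑ˡ k)) (f +ₗ k)      ≡⟨ lookup-∘ₗ (g +ₗ k) (f +ₗ k) (a ↑ˡ k) ⟨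
      lookup ((g +ₗ k) ∘ₗ (f +ₗ k)) (a ↑ˡ k)       ∎
    right : ∀ b → lookup ((g ∘ₗ f) +ₗ k) (n'' ↑ʳ b) ≡ lookup ((g +ₗ k) ∘ₗ (f +ₗ k)) (n'' ↑ʳ b)
    right b = begin
      lookup ((g ∘ₗ f) +ₗ k) (n'' ↑ʳ b)         ≡⟨ lookup-+ₗ-↑ʳ (g ∘ₗ f) k b ⟩
      var (n ↑ʳ b)                              ≡⟨ lookup-+ₗ-↑ʳ f k b ⟨
      sub (var (n' ↑ʳ b)) (f +ₗ k)              ≡⟨ cong (λ t → sub t (f +ₗ k)) (lookup-+ₗ-↑ʳ g k b) ⟨
      sub (lookup (g +ₗ k) (n'' ↑ʳ b)) (f +ₗ k) ≡⟨ lookup-∘ₗ (g +ₗ k) (f +ₗ k) (n'' ↑ʳ b) ⟨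
      lookup ((g +ₗ k) ∘ₗ (f +ₗ k)) (n'' ↑ʳ b)  ∎

  +ₗ-natural : ∀ {n n' k k'} (f : Hom n n') (h : Inj k k') →
               (f +ₗ k) ∘ₗ J (idInj n ⊕ h) ≡ J (idInj n' ⊕ h) ∘ₗ (f +ₗ k')
  +ₗ-natural {n} {n'} {k} {k'} f h = Hom-ext (Fin+-elim _ left right)
    where
    open ≡-Reasoning
    θ  = idInj n ⊕ h
    θ' = idInj n' ⊕ h
    left : ∀ a → lookup ((f +ₗ k) ∘ₗ J θ) (a ↑ˡ k) ≡ lookup (J θ' ∘ₗ (f +ₗ k')) (a ↑ˡ k)
    left a = begin
      lookup ((f +ₗ k) ∘ₗ J θ) (a ↑ˡ k)        ≡⟨ lookup-∘ₗ (f +ₗ k) (J θ) (a ↑ˡ k) ⟩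
      sub (lookup (f +ₗ k) (a ↑ˡ k)) (J θ)     ≡⟨ cong (λ t → sub t (J θ)) (lookup-+ₗ-↑ˡ f k a) ⟩
      sub (sub (lookup f a) (weaken n k)) (J θ) ≡⟨ sub-∘ₗ (lookup f a) (weaken n k) (J θ) ⟩
      sub (lookup f a) (weaken n k ∘ₗ J θ)     ≡⟨ cong (sub (lookup f a)) (ren-∘ₗ-ren (_↑ˡ k) (fun θ)) ⟩
      sub (lookup f a) (ren (fun θ ∘ (_↑ˡ k))) ≡⟨ cong (sub (lookup f a)) (ren-cong (⊕-↑ˡ (idInj n) h)) ⟩
      sub (lookup f a) (weaken n k')           ≡⟨ lookup-+ₗ-↑ˡ f k' a ⟨
      lookup (f +ₗ k') (a ↑ˡ k')               ≡⟨ cong (lookup (f +ₗ k')) (⊕-↑ˡ (idInj n') h a) ⟨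
      lookup (f +ₗ k') (fun θ' (a ↑ˡ k))       ≡⟨ lookup-ren-∘ₗ (fun θ') (f +ₗ k') (a ↑ˡ k) ⟨
      lookup (J θ' ∘ₗ (f +ₗ k')) (a ↑ˡ k)      ∎
    right : ∀ b → lookup ((f +ₗ k) ∘ₗ J θ) (n' ↑ʳ b) ≡ lookup (J θ' ∘ₗ (f +ₗ k')) (n' ↑ʳ b)
    right b = begin
      lookup ((f +ₗ k) ∘ₗ J θ) (n' ↑ʳ b)    ≡⟨ lookup-∘ₗ (f +ₗ k) (J θ) (n' ↑ʳ b) ⟩
      sub (lookup (f +ₗ k) (n' ↑ʳ b)) (J θ) ≡⟨ cong (λ t → sub t (J θ)) (lookup-+ₗ-↑ʳ f k b) ⟩
      lookup (J θ) (n ↑ʳ b)                 ≡⟨ lookup-ren (fun θ) (n ↑ʳ b) ⟩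
      var (fun θ (n ↑ʳ b))                  ≡⟨ cong var (⊕-↑ʳ (idInj n) h b) ⟩
      var (n ↑ʳ fun h b)                    ≡⟨ lookup-+ₗ-↑ʳ f k' (fun h b) ⟨
      lookup (f +ₗ k') (n' ↑ʳ fun h b)      ≡⟨ cong (lookup (f +ₗ k')) (⊕-↑ʳ (idInj n') h b) ⟨
      lookup (f +ₗ k') (fun θ' (n' ↑ʳ b))   ≡⟨ lookup-ren-∘ₗ (fun θ') (f +ₗ k') (n' ↑ʳ b) ⟨
      lookup (J θ' ∘ₗ (f +ₗ k')) (n' ↑ʳ b)  ∎

  J-+ₗ : ∀ {n m} (i : Inj n m) k → J i +ₗ k ≡ J (i ⊕ idInj k)
  J-+ₗ {n} {m} i k = Hom-ext (Fin+-elim _ left right)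
    where
    open ≡-Reasoning
    left : ∀ a → lookup (J i +ₗ k) (a ↑ˡ k) ≡ lookup (J (i ⊕ idInj k)) (a ↑ˡ k)
    left a = begin
      lookup (J i +ₗ k) (a ↑ˡ k)             ≡⟨ lookup-+ₗ-↑ˡ (J i) k a ⟩
      sub (lookup (J i) a) (weaken m k)      ≡⟨ cong (λ t → sub t (weaken m k)) (lookup-ren (fun i) a) ⟩
      lookup (weaken m k) (fun i a)          ≡⟨ lookup-ren (_↑ˡ k) (fun i a) ⟩
      var (fun i a ↑ˡ k)                     ≡⟨ cong var (⊕-↑ˡ i (idInj k) a) ⟨
      var (fun (i ⊕ idInj k) (a ↑ˡ k))       ≡⟨ lookup-ren (fun (i ⊕ idInj k)) (a ↑ˡ k) ⟨
      lookup (J (i ⊕ idInj k)) (a ↑ˡ k)      ∎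
    right : ∀ b → lookup (J i +ₗ k) (n ↑ʳ b) ≡ lookup (J (i ⊕ idInj k)) (n ↑ʳ b)
    right b = begin
      lookup (J i +ₗ k) (n ↑ʳ b)             ≡⟨ lookup-+ₗ-↑ʳ (J i) k b ⟩
      var (m ↑ʳ b)                           ≡⟨ cong var (⊕-↑ʳ i (idInj k) b) ⟨
      var (fun (i ⊕ idInj k) (n ↑ʳ b))       ≡⟨ lookup-ren (fun (i ⊕ idInj k)) (n ↑ʳ b) ⟨
      lookup (J (i ⊕ idInj k)) (n ↑ʳ b)      ∎

  open PosetHomomorphism using () renaming (cong to cong-⟨$⟩; mono to mono-⟨$⟩)

  module _ (H : PFunctor) where

    hom-square : ∀ {n m m' p} (f : Hom n m) (g : Hom m p) (f' : Hom n m') (g' : Hom m' p) →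
                 g ∘ₗ f ≡ g' ∘ₗ f' → ∀ x →
                 Poset._≈_ (obj H n) (hom H f ⟨$⟩ (hom H g ⟨$⟩ x)) (hom H f' ⟨$⟩ (hom H g' ⟨$⟩ x))
    hom-square {n} f g f' g' square x = begin
      hom H f ⟨$⟩ (hom H g ⟨$⟩ x)   ≈⟨ hom-∘ H f g x ⟨
      hom H (g ∘ₗ f) ⟨$⟩ x          ≡⟨ cong (λ e → hom H e ⟨$⟩ x) square ⟩
      hom H (g' ∘ₗ f') ⟨$⟩ x        ≈⟨ hom-∘ H f' g' x ⟩
      hom H f' ⟨$⟩ (hom H g' ⟨$⟩ x) ∎
      where open SetoidReasoning (Poset.Eq.setoid (obj H n))

    hom-resp-≡ : ∀ {n m} {f g : Hom n m} → f ≡ g → ∀ x →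
                 Poset._≈_ (obj H n) (hom H f ⟨$⟩ x) (hom H g ⟨$⟩ x)
    hom-resp-≡ {n} refl x = Poset.Eq.refl (obj H n)

    ρ-cocone : ∀ {n m m'} {j : Inj n m} {j' : Inj n m'} (g : Inj m m') → g ∙ j ≗ j' → ∀ x →
               Poset._≈_ (∫ H n) (ρ[ H ] j ⟨$⟩ x) (ρ[ H ] j' ⟨$⟩ (hom H (J g) ⟨$⟩ x))
    ρ-cocone g g∙j≗j' x = Colim.fwd g g∙j≗j' x ◅ ε , Colim.bwd g g∙j≗j' x ◅ ε

    IsCocone : ∀ n (P : Pos) → (∀ {m} → Inj n m → Mono (obj H m) P) → Set
    IsCocone n P c = ∀ {m m'} {j : Inj n m} {j' : Inj n m'} (g : Inj m m') → g ∙ j ≗ j' → ∀ x →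
                     Poset._≈_ P (c j ⟨$⟩ x) (c j' ⟨$⟩ (hom H (J g) ⟨$⟩ x))

    induced : ∀ {n} (P : Pos) (c : ∀ {m} → Inj n m → Mono (obj H m) P) → IsCocone n P c →
              Mono (∫ H n) P
    induced {n} P c cocone = record
      { ⟦_⟧ = ⟦_⟧
      ; isOrderHomomorphism = record
        { cong = λ (x≤y , y≤x) → P.antisym (mono x≤y) (mono y≤x)
        ; mono = mono } }
      where
      module P = Poset P
      ⟦_⟧ : Colim.Elt H n → P.Carrier
      ⟦ Colim.el m j x ⟧ = c j ⟨$⟩ x
      step : ∀ {X Y} → Colim.Step H n X Y → ⟦ X ⟧ P.≤ ⟦ Y ⟧
      step (Colim.within {j = j} x≤y) = mono-⟨$⟩ (c j) x≤y
      step (Colim.fwd g g∙j≗j' x)     = P.reflexive (cocone g g∙j≗j' x)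
      step (Colim.bwd g g∙j≗j' x)     = P.reflexive (P.Eq.sym (cocone g g∙j≗j' x))
      mono : ∀ {X Y} → Poset._≤_ (∫ H n) X Y → ⟦ X ⟧ P.≤ ⟦ Y ⟧
      mono = gfold ⟦_⟧ P._≤_ (λ s r → P.trans (step s) r) P.refl

    -- The cocone defining ∫H(f), extended from the canonical injections along toCanonical j.
    actComponent : ∀ {n n' m} → Hom n n' → Inj n' m → Mono (obj H m) (∫ H n)
    actComponent {n} {m = m} f j = ρ[ H ] (incl n m) ∘ᴹ hom H (f +ₗ m) ∘ᴹ hom H (J (toCanonical j))

    canonical-cocone : ∀ {n n' k k'} (f : Hom n n') (h : Inj k k') y →
      Poset._≈_ (∫ H n) (ρ[ H ] (incl n k) ⟨$⟩ (hom H (f +ₗ k) ⟨$⟩ y))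
        (ρ[ H ] (incl n k') ⟨$⟩ (hom H (f +ₗ k') ⟨$⟩ (hom H (J (idInj n' ⊕ h)) ⟨$⟩ y)))
    canonical-cocone {n} {n'} {k} {k'} f h y = begin
      ρ[ H ] (incl n k) ⟨$⟩ (hom H (f +ₗ k) ⟨$⟩ y)
        ≈⟨ ρ-cocone (idInj n ⊕ h) (⊕-↑ˡ (idInj n) h) _ ⟩
      ρ[ H ] (incl n k') ⟨$⟩ (hom H (J (idInj n ⊕ h)) ⟨$⟩ (hom H (f +ₗ k) ⟨$⟩ y))
        ≈⟨ cong-⟨$⟩ (ρ[ H ] (incl n k')) (hom-square _ _ _ _ (+ₗ-natural f h) y) ⟩
      ρ[ H ] (incl n k') ⟨$⟩ (hom H (f +ₗ k') ⟨$⟩ (hom H (J (idInj n' ⊕ h)) ⟨$⟩ y)) ∎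
      where open SetoidReasoning (Poset.Eq.setoid (∫ H n))

    actComponent-cocone : ∀ {n n'} (f : Hom n n') → IsCocone n' (∫ H n) (actComponent f)
    actComponent-cocone {n} {n'} f {m} {m'} {j} {j'} g g∙j≗j' x = begin
      actComponent f j ⟨$⟩ x
        ≈⟨ canonical-cocone f g _ ⟩
      ρ[ H ] (incl n m') ⟨$⟩ (hom H (f +ₗ m') ⟨$⟩
        (hom H (J (idInj n' ⊕ g)) ⟨$⟩ (hom H (J (toCanonical j)) ⟨$⟩ x)))
        ≈⟨ cong-⟨$⟩ (ρ[ H ] (incl n m')) (cong-⟨$⟩ (hom H (f +ₗ m'))
             (hom-square _ _ _ _ (J-square (idInj n' ⊕ g) (toCanonical j) (toCanonical j') g
               (toCanonical-natural g g∙j≗j')) x)) ⟩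
      actComponent f j' ⟨$⟩ (hom H (J g) ⟨$⟩ x) ∎
      where open SetoidReasoning (Poset.Eq.setoid (∫ H n))

    ∫-act : ∀ {n n'} → Hom n n' → Mono (∫ H n') (∫ H n)
    ∫-act {n} f = induced (∫ H n) (actComponent f) (actComponent-cocone f)

    ∫-act-ρ : ∀ {n n'} (f : Hom n n') k (x : Poset.Carrier (obj H (n' + k))) →
              Poset._≈_ (∫ H n) (∫-act f ⟨$⟩ (ρ[ H ] (incl n' k) ⟨$⟩ x))
                                (ρ[ H ] (incl n k) ⟨$⟩ (hom H (f +ₗ k) ⟨$⟩ x))
    ∫-act-ρ {n} {n'} f k x = begin
      actComponent f (incl n' k) ⟨$⟩ x
        ≡⟨ cong (λ e → ρ[ H ] (incl n (n' + k)) ⟨$⟩ (hom H (f +ₗ (n' + k)) ⟨$⟩ (hom H e ⟨$⟩ x)))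
                (ren-cong (toCanonical-incl n' k)) ⟩
      ρ[ H ] (incl n (n' + k)) ⟨$⟩ (hom H (f +ₗ (n' + k)) ⟨$⟩ (hom H (J (idInj n' ⊕ inclʳ n' k)) ⟨$⟩ x))
        ≈⟨ canonical-cocone f (inclʳ n' k) x ⟨
      ρ[ H ] (incl n k) ⟨$⟩ (hom H (f +ₗ k) ⟨$⟩ x) ∎
      where open SetoidReasoning (Poset.Eq.setoid (∫ H n))

    ∫-act-id : ∀ n (x : Poset.Carrier (∫ H n)) → Poset._≈_ (∫ H n) (∫-act (idₗ n) ⟨$⟩ x) x
    ∫-act-id n (Colim.el m j x) = begin
      actComponent (idₗ n) j ⟨$⟩ x
        ≈⟨ cong-⟨$⟩ (ρ[ H ] (incl n m))
             (Poset.Eq.trans (obj H (n + m)) (hom-resp-≡ (+ₗ-identity n m) y) (hom-id H (n + m) y)) ⟩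
      ρ[ H ] (incl n m) ⟨$⟩ y
        ≈⟨ ρ-cocone (toCanonical j) (toCanonical-∙ j) x ⟨
      ρ[ H ] j ⟨$⟩ x ∎
      where
      open SetoidReasoning (Poset.Eq.setoid (∫ H n))
      y = hom H (J (toCanonical j)) ⟨$⟩ x

    ∫-act-∘ : ∀ {n n' n''} (f : Hom n n') (g : Hom n' n'') (x : Poset.Carrier (∫ H n'')) →
              Poset._≈_ (∫ H n) (∫-act (g ∘ₗ f) ⟨$⟩ x) (∫-act f ⟨$⟩ (∫-act g ⟨$⟩ x))
    ∫-act-∘ {n} f g (Colim.el m j x) = begin
      ρ[ H ] (incl n m) ⟨$⟩ (hom H ((g ∘ₗ f) +ₗ m) ⟨$⟩ y)
        ≈⟨ cong-⟨$⟩ (ρ[ H ] (incl n m)) (Poset.Eq.trans (obj H (n + m))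
             (hom-resp-≡ (+ₗ-∘ₗ f g m) y) (hom-∘ H (f +ₗ m) (g +ₗ m) y)) ⟩
      ρ[ H ] (incl n m) ⟨$⟩ (hom H (f +ₗ m) ⟨$⟩ (hom H (g +ₗ m) ⟨$⟩ y))
        ≈⟨ ∫-act-ρ f m (hom H (g +ₗ m) ⟨$⟩ y) ⟨
      ∫-act f ⟨$⟩ (ρ[ H ] (incl _ m) ⟨$⟩ (hom H (g +ₗ m) ⟨$⟩ y)) ∎
      where
      open SetoidReasoning (Poset.Eq.setoid (∫ H n))
      y = hom H (J (toCanonical j)) ⟨$⟩ x

    ∫-functorData : ∫FunctorData H
    ∫-functorData = record { act = ∫-act ; act-ρ = ∫-act-ρ ; act-id = ∫-act-id ; act-∘ = ∫-act-∘ }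

  module _ {H K : PFunctor} (α : LaxInj H K) where

    ∫-comp : ∀ n → Mono (∫ H n) (∫ K n)
    ∫-comp n = induced H (∫ K n) (λ j → ρ[ K ] j ∘ᴹ comp α _) cocone
      where
      cocone : IsCocone H n (∫ K n) (λ j → ρ[ K ] j ∘ᴹ comp α _)
      cocone {m} {m'} {j} {j'} g g∙j≗j' x = begin
        ρ[ K ] j ⟨$⟩ (comp α m ⟨$⟩ x)
          ≈⟨ ρ-cocone K g g∙j≗j' _ ⟩
        ρ[ K ] j' ⟨$⟩ (hom K (J g) ⟨$⟩ (comp α m ⟨$⟩ x))
          ≈⟨ cong-⟨$⟩ (ρ[ K ] j') (strict α g x) ⟩
        ρ[ K ] j' ⟨$⟩ (comp α m' ⟨$⟩ (hom H (J g) ⟨$⟩ x)) ∎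
        where open SetoidReasoning (Poset.Eq.setoid (∫ K n))

    ∫-comp-lax : ∀ {n n'} (f : Hom n n') (X : Poset.Carrier (∫ H n')) →
                 Poset._≤_ (∫ K n) (∫-act K f ⟨$⟩ (∫-comp n' ⟨$⟩ X))
                                   (∫-comp n ⟨$⟩ (∫-act H f ⟨$⟩ X))
    ∫-comp-lax {n} f (Colim.el m j x) = mono-⟨$⟩ (ρ[ K ] (incl n m)) (begin
      hom K (f +ₗ m) ⟨$⟩ (hom K (J e) ⟨$⟩ (comp α m ⟨$⟩ x))
        ≈⟨ cong-⟨$⟩ (hom K (f +ₗ m)) (strict α e x) ⟩
      hom K (f +ₗ m) ⟨$⟩ (comp α (_ + m) ⟨$⟩ (hom H (J e) ⟨$⟩ x))
        ≤⟨ lax α (f +ₗ m) _ ⟩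
      comp α (n + m) ⟨$⟩ (hom H (f +ₗ m) ⟨$⟩ (hom H (J e) ⟨$⟩ x)) ∎)
      where
      open PosetReasoning (obj K (n + m)) hiding (strict)
      e = toCanonical j

    ∫-comp-strict : ∀ {n m} (i : Inj n m) (X : Poset.Carrier (∫ H n)) →
                    Poset._≈_ (∫ K m) (∫-act K (J i) ⟨$⟩ (∫-comp n ⟨$⟩ X))
                                      (∫-comp m ⟨$⟩ (∫-act H (J i) ⟨$⟩ X))
    ∫-comp-strict {n} {m} i (Colim.el p j x) = cong-⟨$⟩ (ρ[ K ] (incl m p)) (begin
      hom K (J i +ₗ p) ⟨$⟩ (hom K (J e) ⟨$⟩ (comp α p ⟨$⟩ x))
        ≈⟨ cong-⟨$⟩ (hom K (J i +ₗ p)) (strict α e x) ⟩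
      hom K (J i +ₗ p) ⟨$⟩ (comp α (n + p) ⟨$⟩ y)
        ≈⟨ hom-resp-≡ K (J-+ₗ i p) _ ⟩
      hom K (J (i ⊕ idInj p)) ⟨$⟩ (comp α (n + p) ⟨$⟩ y)
        ≈⟨ strict α (i ⊕ idInj p) y ⟩
      comp α (m + p) ⟨$⟩ (hom H (J (i ⊕ idInj p)) ⟨$⟩ y)
        ≈⟨ cong-⟨$⟩ (comp α (m + p)) (hom-resp-≡ H (J-+ₗ i p) y) ⟨
      comp α (m + p) ⟨$⟩ (hom H (J i +ₗ p) ⟨$⟩ y) ∎)
      where
      open SetoidReasoning (Poset.Eq.setoid (obj K (m + p)))
      e = toCanonical j
      y = hom H (J e) ⟨$⟩ x

    ∫-mapData : ∫MapData (∫-functorData H) (∫-functorData K) α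
    ∫-mapData = record
      { map   = record { comp = ∫-comp ; lax = ∫-comp-lax ; strict = ∫-comp-strict }
      ; map-ρ = λ n k x → Poset.Eq.refl (∫ K n) }

-- ∫α acts on representatives by α, so ∫ preserves identities and composition on the nose.
proposition20 : (Sig : Signature) → let open Lawvere Sig in
    Σ[ D ∈ ((H : PFunctor) → ∫FunctorData H) ]
    Σ[ A ∈ (∀ {H K} (α : LaxInj H K) → ∫MapData (D H) (D K) α) ]
      ((∀ H n (x : Poset.Carrier (∫ H n)) →
          Poset._≈_ (∫ H n) (comp (∫MapData.map (A (idLax H))) n ⟨$⟩ x) x)
      × (∀ {H K L} (α : LaxInj H K) (β : LaxInj K L) n (x : Poset.Carrier (∫ H n)) →
          Poset._≈_ (∫ L n)
            (comp (∫MapData.map (A (β ∘Lax α))) n ⟨$⟩ x)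
            (comp (∫MapData.map (A β)) n ⟨$⟩ (comp (∫MapData.map (A α)) n ⟨$⟩ x))))
proposition20 Sig =
  ∫-functorData Sig , ∫-mapData Sig ,
  (λ H n x → Poset.Eq.refl (∫ H n)) , (λ {L = L} α β n x → Poset.Eq.refl (∫ L n))
  where open Lawvere Sig
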